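{- Let $n\in\mathbb{N}$, $m,p\in\mathbb{N}_0$ and $\lambda\in\mathbb{C}$. Then \[ y_{6}(m,n;\lambda,p)=\frac{1}{n!\,2^{n}}\sum_{k=0}^{n}\sum_{v=0}^{m}\binom{n}{k}^{p}\binom{m}{v}\lambda^{k}B(v,n)E_{m-v}^{(n)}(k). \]
   Context: $y_6(m,n;\lambda,p)=\frac{1}{n!}\sum_{k=0}^{n}\binom{n}{k}^{p}k^{m}\lambda^{k}$ (with $0^0=1$). $B(v,n)=\sum_{i=0}^{n}\binom{n}{i}i^{v}$ (with $0^0=1$), equivalently $(e^t+1)^n=\sum_{v\ge0}B(v,n)\frac{t^v}{v!}$. The Euler polynomials of order $n$ are defined by $\left(\frac{2}{e^t+1}\right)^n e^{tx}=\sum_{r\ge0}E_r^{(n)}(x)\frac{t^r}{r!}$. -}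

module Defs where

open import Level using (Level)
open import Data.Nat as ℕ using (ℕ; zero; suc; _∸_)
open import Data.Nat using (_!)
open import Data.Nat.Combinatorics using (_C_)
open import Data.Nat.Properties using (m*n≢0; m^n≢0; _!≢0)
open import Data.Integer using (+_)
open import Data.Rational as ℚ using (ℚ; 0ℚ; 1ℚ; _/_)
open import Data.Rational.Properties using (+-*-commutativeRing)
open import Data.List using (List; []; _∷_; _++_)
open import Algebra.Bundles using (CommutativeRing)
open import Algebra.Morphism.Structures using (module RingMorphisms)

ℕ→ℚ : ℕ → ℚ
ℕ→ℚ n = (+ n) / 1

_^ℚ_ : ℚ → ℕ → ℚ
x ^ℚ zero = 1ℚ
x ^ℚ suc k = x ℚ.* (x ^ℚ k)

Σℚ≤ : ℕ → (ℕ → ℚ) → ℚ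
Σℚ≤ zero f = f zero
Σℚ≤ (suc n) f = Σℚ≤ n f ℚ.+ f (suc n)

Σℕ≤ : ℕ → (ℕ → ℕ) → ℕ
Σℕ≤ zero f = f zero
Σℕ≤ (suc n) f = Σℕ≤ n f ℕ.+ f (suc n)

-- Exponential generating functions with rational coefficients:
-- a series F(t) = Σ_r f r t^r / r!  is represented by  f : ℕ → ℚ.

EGF : Set
EGF = ℕ → ℚ

_⊛_ : EGF → EGF → EGF
(f ⊛ g) r = Σℚ≤ r (λ j → ℕ→ℚ (r C j) ℚ.* (f j ℚ.* g (r ∸ j)))

oneE : EGF
oneE zero = 1ℚ
oneE (suc r) = 0ℚ

_^E_ : EGF → ℕ → EGF
F ^E zero = oneE
F ^E suc n = F ⊛ (F ^E n)

expE : ℚ → EGF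
expE x r = x ^ℚ r

at : List ℚ → ℕ → ℚ
at [] _ = 0ℚ
at (x ∷ xs) zero = x
at (x ∷ xs) (suc i) = at xs i

-- The series A(t) = 2/(e^t+1), i.e. the unique EGF with (e^t + 1)·A(t) = 2.
-- Comparing coefficients of t^r/r!:  2 a_0 = 2  and, for r ≥ 1,
-- Σ_{j=0}^{r} C(r,j) a_j + a_r = 0, i.e. a_r = -(1/2) Σ_{j<r} C(r,j) a_j.
-- twoOverPrefix r = [a_0, …, a_r].
twoOverPrefix : ℕ → List ℚ
twoOverPrefix zero = 1ℚ ∷ []
twoOverPrefix (suc r) =
  twoOverPrefix r ++
  ((ℚ.- (1ℤ / 2)) ℚ.* Σℚ≤ r (λ j → ℕ→ℚ (suc r C j) ℚ.* at (twoOverPrefix r) j) ∷ [])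
  where 1ℤ = + 1

twoOverExpPlusOne : EGF
twoOverExpPlusOne r = at (twoOverPrefix r) r

EulerPoly : ℕ → ℕ → ℚ → ℚ
EulerPoly n r x = ((twoOverExpPlusOne ^E n) ⊛ expE x) r

-- B(v,n) = Σ_{i=0}^{n} C(n,i) i^v   (0^0 = 1)
B : ℕ → ℕ → ℕ
B v n = Σℕ≤ n (λ i → (n C i) ℕ.* (i ℕ.^ v))

-- Statements over a commutative ring R receiving a ring homomorphism
-- ι : ℚ → R  (i.e. a ℚ-algebra, e.g. ℂ).

ℚ-ring : CommutativeRing _ _
ℚ-ring = +-*-commutativeRing

inv-n! : ℕ → ℚ
inv-n! n = (+ 1) / (n !)
  where instance _ = n !≢0

inv-n!2^n : ℕ → ℚ
inv-n!2^n n = (+ 1) / ((n !) ℕ.* (2 ℕ.^ n))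
  where instance
          _ = n !≢0
          _ = m^n≢0 2 n
          _ = m*n≢0 (n !) (2 ℕ.^ n)

module OverAlgebra {c ℓ : Level} (R : CommutativeRing c ℓ) (ι : ℚ → CommutativeRing.Carrier R) where
  open CommutativeRing R using (Carrier; _+_; _*_; 1#)

  powR : Carrier → ℕ → Carrier
  powR x zero = 1#
  powR x (suc k) = x * powR x k

  ΣR≤ : ℕ → (ℕ → Carrier) → Carrier
  ΣR≤ zero f = f zero
  ΣR≤ (suc n) f = ΣR≤ n f + f (suc n)

  y6 : ℕ → ℕ → Carrier → ℕ → Carrier
  y6 m n lam p =
    ι (inv-n! n) * ΣR≤ n (λ k → ι (ℕ→ℚ (((n C k) ℕ.^ p) ℕ.* (k ℕ.^ m))) * powR lam k)

  rhs15 : ℕ → ℕ → Carrier → ℕ → Carrier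
  rhs15 m n lam p =
    ι (inv-n!2^n n) *
    ΣR≤ n (λ k → ΣR≤ m (λ v →
      ι (ℕ→ℚ ((n C k) ℕ.^ p)) * ι (ℕ→ℚ (m C v)) * powR lam k
        * ι (ℕ→ℚ (B v n)) * ι (EulerPoly n (m ∸ v) (ℕ→ℚ k))))

module Submission where

-- Write S(t) = e^t + 1 and A(t) = 2/(e^t + 1), so that
-- S(t) A(t) = 2 and hence S(t)^n A(t)^n = 2^n.  Comparing coefficients of
-- t^m/m! in
--     (e^t + 1)^n · (2/(e^t + 1))^n e^{kt} = 2^n e^{kt}
-- and using (e^t + 1)^n = Σ_v B(v,n) t^v/v! gives, for every k,
--     Σ_{v=0}^{m} C(m,v) B(v,n) E_{m-v}^{(n)}(k) = 2^n k^m.            (*)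
-- Multiplying (*) by C(n,k)^p λ^k / (n! 2^n) and summing over k yields the
-- theorem (which therefore also holds for n = 0).  Series are exponential
-- generating functions with rational coefficients, multiplied by binomial
-- convolution; the final identity is transported to R along ι : ℚ → R.

open import Defs
open import Data.Nat as ℕ using (ℕ; zero; suc; _∸_; _≤_; _<_; z≤n; s≤s; _!)
import Data.Nat.Properties as ℕP
open import Data.Nat.Combinatorics using (_C_)
open import Data.Rational as ℚ using (ℚ; 0ℚ; 1ℚ)
import Data.Rational.Properties as ℚP
open import Data.Rational.Solver using (module +-*-Solver)
open import Relation.Binary.PropositionalEquality
  using (_≡_; refl; sym; trans; cong; cong₂; subst; module ≡-Reasoning)
open import Algebra.Bundles using (CommutativeRing)
open import Algebra.Morphism.Structures using (module RingMorphisms)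

module NatCast where

  open import Data.Integer as ℤ using (+_)
  import Data.Integer.Properties as ℤP
  import Data.Rational.Unnormalised as U
  import Data.Rational.Unnormalised.Properties as UP
  open import Data.Rational using (_+_; _*_)

  toℚᵘ-ℕ→ℚ : ∀ n → ℚ.toℚᵘ (ℕ→ℚ n) U.≃ U.mkℚᵘ (+ n) 0
  toℚᵘ-ℕ→ℚ n = ℚP.toℚᵘ-fromℚᵘ (U.mkℚᵘ (+ n) 0)

  ℕ→ℚ-+ : ∀ a b → ℕ→ℚ (a ℕ.+ b) ≡ ℕ→ℚ a + ℕ→ℚ b
  ℕ→ℚ-+ a b = ℚP.toℚᵘ-injective (UP.≃-trans (toℚᵘ-ℕ→ℚ (a ℕ.+ b)) (UP.≃-trans sum-of-integers
    (UP.≃-sym (UP.≃-trans (ℚP.toℚᵘ-homo-+ (ℕ→ℚ a) (ℕ→ℚ b)) (UP.+-cong (toℚᵘ-ℕ→ℚ a) (toℚᵘ-ℕ→ℚ b))))))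
    where
    sum-of-integers : U.mkℚᵘ (+ (a ℕ.+ b)) 0 U.≃ (U.mkℚᵘ (+ a) 0 U.+ U.mkℚᵘ (+ b) 0)
    sum-of-integers = U.*≡* (cong (ℤ._* + 1) (trans (ℤP.pos-+ a b)
      (sym (cong₂ ℤ._+_ (ℤP.*-identityʳ (+ a)) (ℤP.*-identityʳ (+ b))))))

  ℕ→ℚ-* : ∀ a b → ℕ→ℚ (a ℕ.* b) ≡ ℕ→ℚ a * ℕ→ℚ b
  ℕ→ℚ-* a b = ℚP.toℚᵘ-injective (UP.≃-trans (toℚᵘ-ℕ→ℚ (a ℕ.* b)) (UP.≃-trans product-of-integers
    (UP.≃-sym (UP.≃-trans (ℚP.toℚᵘ-homo-* (ℕ→ℚ a) (ℕ→ℚ b)) (UP.*-cong (toℚᵘ-ℕ→ℚ a) (toℚᵘ-ℕ→ℚ b))))))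
    where
    product-of-integers : U.mkℚᵘ (+ (a ℕ.* b)) 0 U.≃ (U.mkℚᵘ (+ a) 0 U.* U.mkℚᵘ (+ b) 0)
    product-of-integers = U.*≡* (cong (ℤ._* + 1) (ℤP.pos-* a b))

  ℕ→ℚ-^ : ∀ k m → ℕ→ℚ (k ℕ.^ m) ≡ ℕ→ℚ k ^ℚ m
  ℕ→ℚ-^ k zero    = refl
  ℕ→ℚ-^ k (suc m) = trans (ℕ→ℚ-* k (k ℕ.^ m)) (cong (ℕ→ℚ k *_) (ℕ→ℚ-^ k m))

  ℕ→ℚ-Σ : ∀ n h → ℕ→ℚ (Σℕ≤ n h) ≡ Σℚ≤ n (λ i → ℕ→ℚ (h i))
  ℕ→ℚ-Σ zero    h = refl
  ℕ→ℚ-Σ (suc n) h = trans (ℕ→ℚ-+ (Σℕ≤ n h) (h (suc n))) (cong (_+ ℕ→ℚ (h (suc n))) (ℕ→ℚ-Σ n h))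

  inverse-cancel : ∀ d .{{_ : ℕ.NonZero d}} → ((+ 1) ℚ./ d) * ℕ→ℚ d ≡ 1ℚ
  inverse-cancel (suc d) = ℚP.toℚᵘ-injective (UP.≃-trans (ℚP.toℚᵘ-homo-* ((+ 1) ℚ./ suc d) (ℕ→ℚ (suc d)))
    (UP.≃-trans (UP.*-cong (ℚP.toℚᵘ-fromℚᵘ (U.mkℚᵘ (+ 1) d)) (toℚᵘ-ℕ→ℚ (suc d))) (U.*≡* cross-multiplied)))
    where
    cross-multiplied : ((+ 1) ℤ.* (+ suc d)) ℤ.* (+ 1) ≡ (+ 1) ℤ.* (+ (suc d ℕ.* 1))
    cross-multiplied = trans (ℤP.*-identityʳ _) (trans (ℤP.*-identityˡ _)
      (sym (trans (ℤP.*-identityˡ _) (cong +_ (ℕP.*-identityʳ (suc d))))))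

  normaliser-ratio : ∀ n → inv-n!2^n n * ℕ→ℚ (2 ℕ.^ n) ≡ inv-n! n
  normaliser-ratio n = begin
    X * T                    ≡⟨ sym (ℚP.*-identityʳ (X * T)) ⟩
    X * T * 1ℚ               ≡⟨ cong (X * T *_) (sym (trans (ℚP.*-comm D I) (inverse-cancel (n !) {{n ℕP.!≢0}}))) ⟩
    X * T * (D * I)          ≡⟨ solve 4 (λ X T D I → X :* T :* (D :* I) := (X :* (D :* T)) :* I) refl X T D I ⟩
    (X * (D * T)) * I        ≡⟨ cong (λ z → (X * z) * I) (sym (ℕ→ℚ-* (n !) (2 ℕ.^ n))) ⟩
    (X * ℕ→ℚ (n ! ℕ.* 2 ℕ.^ n)) * I
      ≡⟨ cong (_* I) (inverse-cancel (n ! ℕ.* 2 ℕ.^ n) {{ℕP.m*n≢0 (n !) (2 ℕ.^ n) {{n ℕP.!≢0}} {{ℕP.m^n≢0 2 n}}}}) ⟩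
    1ℚ * I                   ≡⟨ ℚP.*-identityˡ I ⟩
    I ∎
    where
    open ≡-Reasoning
    open +-*-Solver
    X T D I : ℚ
    X = inv-n!2^n n
    T = ℕ→ℚ (2 ℕ.^ n)
    D = ℕ→ℚ (n !)
    I = inv-n! n

module FiniteSums where

  open import Data.Rational using (_+_; _*_)
  open import Algebra.Bundles using (CommutativeMonoid)
  open import Algebra.Properties.CommutativeSemigroup
    (CommutativeMonoid.commutativeSemigroup ℚP.+-0-commutativeMonoid) using (interchange)
  open ≡-Reasoning

  Σ : ℕ → (ℕ → ℚ) → ℚ
  Σ = Σℚ≤

  Σ-cong≤ : ∀ n {f g : ℕ → ℚ} → (∀ i → i ≤ n → f i ≡ g i) → Σ n f ≡ Σ n g
  Σ-cong≤ zero    f≡g = f≡g 0 z≤n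
  Σ-cong≤ (suc n) f≡g =
    cong₂ _+_ (Σ-cong≤ n (λ i i≤n → f≡g i (ℕP.m≤n⇒m≤1+n i≤n))) (f≡g (suc n) ℕP.≤-refl)

  Σ-cong : ∀ n {f g : ℕ → ℚ} → (∀ i → f i ≡ g i) → Σ n f ≡ Σ n g
  Σ-cong n f≡g = Σ-cong≤ n (λ i _ → f≡g i)

  Σ-+ : ∀ n (f g : ℕ → ℚ) → Σ n (λ i → f i + g i) ≡ Σ n f + Σ n g
  Σ-+ zero    f g = refl
  Σ-+ (suc n) f g = trans (cong (_+ (f (suc n) + g (suc n))) (Σ-+ n f g))
                          (interchange (Σ n f) (Σ n g) (f (suc n)) (g (suc n)))

  Σ-*ˡ : ∀ n a (f : ℕ → ℚ) → a * Σ n f ≡ Σ n (λ i → a * f i)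
  Σ-*ˡ zero    a f = refl
  Σ-*ˡ (suc n) a f =
    trans (ℚP.*-distribˡ-+ a (Σ n f) (f (suc n))) (cong (_+ a * f (suc n)) (Σ-*ˡ n a f))

  Σ-*ʳ : ∀ n a (f : ℕ → ℚ) → Σ n f * a ≡ Σ n (λ i → f i * a)
  Σ-*ʳ n a f = trans (ℚP.*-comm (Σ n f) a)
                     (trans (Σ-*ˡ n a f) (Σ-cong n (λ i → ℚP.*-comm a (f i))))

  Σ-zero : ∀ n → Σ n (λ _ → 0ℚ) ≡ 0ℚ
  Σ-zero zero    = refl
  Σ-zero (suc n) = cong (_+ 0ℚ) (Σ-zero n)

  Σ-head : ∀ n (f : ℕ → ℚ) → Σ (suc n) f ≡ f 0 + Σ n (λ i → f (suc i))
  Σ-head zero    f = refl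
  Σ-head (suc n) f = trans (cong (_+ f (suc (suc n))) (Σ-head n f))
                           (ℚP.+-assoc (f 0) _ _)

  Σ-reverse : ∀ n (f : ℕ → ℚ) → Σ n f ≡ Σ n (λ i → f (n ∸ i))
  Σ-reverse zero    f = refl
  Σ-reverse (suc n) f = begin
    Σ n f + f (suc n)                  ≡⟨ ℚP.+-comm (Σ n f) (f (suc n)) ⟩
    f (suc n) + Σ n f                  ≡⟨ cong (f (suc n) +_) (Σ-reverse n f) ⟩
    f (suc n) + Σ n (λ i → f (n ∸ i))  ≡⟨ sym (Σ-head n (λ i → f (suc n ∸ i))) ⟩
    Σ (suc n) (λ i → f (suc n ∸ i))    ∎

  Σ-swap : ∀ n m (F : ℕ → ℕ → ℚ) →
    Σ n (λ i → Σ m (λ j → F i j)) ≡ Σ m (λ j → Σ n (λ i → F i j))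
  Σ-swap zero    m F = refl
  Σ-swap (suc n) m F = trans (cong (_+ Σ m (F (suc n))) (Σ-swap n m F))
                             (sym (Σ-+ m _ (F (suc n))))

  Σ-triangle : ∀ N (F : ℕ → ℕ → ℚ) →
    Σ N (λ r → Σ r (F r)) ≡ Σ N (λ j → Σ (N ∸ j) (λ l → F (j ℕ.+ l) j))
  Σ-triangle zero    F = refl
  Σ-triangle (suc N) F = begin
    Σ N (λ r → Σ r (F r)) + (Σ N (F (suc N)) + F (suc N) (suc N))
      ≡⟨ cong (_+ (Σ N (F (suc N)) + F (suc N) (suc N))) (Σ-triangle N F) ⟩
    Old + (Σ N (F (suc N)) + F (suc N) (suc N))
      ≡⟨ sym (ℚP.+-assoc Old (Σ N (F (suc N))) (F (suc N) (suc N))) ⟩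
    (Old + Σ N (F (suc N))) + F (suc N) (suc N)
      ≡⟨ cong₂ _+_ (trans (sym (Σ-+ N _ _)) (Σ-cong≤ N extend-column))
                   (cong (λ x → F x (suc N)) (sym (ℕP.+-identityʳ (suc N)))) ⟩
    Σ N (column (suc N)) + F (suc N ℕ.+ 0) (suc N)
      ≡⟨ cong (λ x → Σ N (column (suc N)) + Σ x (λ l → F (suc N ℕ.+ l) (suc N)))
              (sym (ℕP.n∸n≡0 N)) ⟩
    Σ (suc N) (column (suc N)) ∎
    where
    column : ℕ → ℕ → ℚ
    column M j = Σ (M ∸ j) (λ l → F (j ℕ.+ l) j)
    Old : ℚ
    Old = Σ N (column N)
    extend-column : ∀ j → j ≤ N → column N j + F (suc N) j ≡ column (suc N) j
    extend-column j j≤N rewrite ℕP.+-∸-assoc 1 j≤N =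
      cong (λ x → column N j + F x j)
        (trans (cong suc (sym (ℕP.m+[n∸m]≡n j≤N))) (sym (ℕP.+-suc j (N ∸ j))))

module SeriesRing where

  open import Data.Nat.Combinatorics using (nCk≡nC[n∸k]; nCk≡n!/k![n-k]!; k![n∸k]!∣n!)
  open import Data.Nat.DivMod using (m/n*n≡m)
  open import Data.Fin using (toℕ)
  open import Data.Rational using (_+_; _*_)
  import Data.Nat.Solver as ℕSolver
  import Algebra.Properties.CommutativeSemiring.Binomial as Binomial
  open import Algebra.Bundles using (Semiring)
  open import Algebra.Definitions.RawSemiring (Semiring.rawSemiring (CommutativeRing.semiring ℚ-ring))
    using () renaming (_^_ to _^ᴿ_; _×_ to _×ᴿ_; sum to sumᴿ)
  open NatCast
  open FiniteSums
  open ≡-Reasoning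

  infix 4 _≋_
  _≋_ : EGF → EGF → Set
  f ≋ g = ∀ r → f r ≡ g r

  ≋-trans : ∀ {f g h} → f ≋ g → g ≋ h → f ≋ h
  ≋-trans f≋g g≋h r = trans (f≋g r) (g≋h r)

  binom : ℕ → ℕ → ℚ
  binom r j = ℕ→ℚ (r C j)

  C-factorial : ∀ {n k} → k ≤ n → (n C k) ℕ.* (k ! ℕ.* (n ∸ k) !) ≡ n !
  C-factorial {n} {k} k≤n =
    trans (cong (ℕ._* (k ! ℕ.* (n ∸ k) !)) (nCk≡n!/k![n-k]! k≤n)) (m/n*n≡m (k![n∸k]!∣n! k≤n))
    where instance
            _ = k ℕP.!≢0
            _ = (n ∸ k) ℕP.!≢0
            _ = ℕP.m*n≢0 (k !) ((n ∸ k) !)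

  -- Choosing i+l out of r and then i out of those equals choosing i out of r
  -- and then l out of the remaining r-i:  C(r,i+l) C(i+l,i) = C(r,i) C(r-i,l).
  C-subset-of-subset : ∀ r i l → i ℕ.+ l ≤ r →
    (r C (i ℕ.+ l)) ℕ.* ((i ℕ.+ l) C i) ≡ (r C i) ℕ.* ((r ∸ i) C l)
  C-subset-of-subset r i l i+l≤r =
    ℕP.*-cancelʳ-≡ _ _ (x ℕ.* (y ℕ.* z)) (trans left-side (sym right-side))
    where
    open ℕSolver.+-*-Solver
    x y z : ℕ
    x = i !
    y = l !
    z = (r ∸ (i ℕ.+ l)) !
    instance
      _ = ℕP.m*n≢0 x (y ℕ.* z) {{i ℕP.!≢0}} {{ℕP.m*n≢0 y z {{l ℕP.!≢0}} {{(r ∸ (i ℕ.+ l)) ℕP.!≢0}}}}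
    a b d e : ℕ
    a = r C (i ℕ.+ l)
    b = (i ℕ.+ l) C i
    d = r C i
    e = (r ∸ i) C l
    bxy : b ℕ.* (x ℕ.* y) ≡ (i ℕ.+ l) !
    bxy = trans (cong (λ t → b ℕ.* (x ℕ.* (t !))) (sym (ℕP.m+n∸m≡n i l))) (C-factorial (ℕP.m≤m+n i l))
    eyz : e ℕ.* (y ℕ.* z) ≡ (r ∸ i) !
    eyz = trans (cong (λ t → e ℕ.* (y ℕ.* (t !))) (sym (ℕP.∸-+-assoc r i l)))
                (C-factorial (ℕP.m+n≤o⇒m≤o∸n l (subst (_≤ r) (ℕP.+-comm i l) i+l≤r)))
    left-side : (a ℕ.* b) ℕ.* (x ℕ.* (y ℕ.* z)) ≡ r !
    left-side = begin
      (a ℕ.* b) ℕ.* (x ℕ.* (y ℕ.* z))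
        ≡⟨ solve 5 (λ a b x y z → (a :* b) :* (x :* (y :* z)) := a :* ((b :* (x :* y)) :* z)) refl a b x y z ⟩
      a ℕ.* ((b ℕ.* (x ℕ.* y)) ℕ.* z) ≡⟨ cong (λ t → a ℕ.* (t ℕ.* z)) bxy ⟩
      a ℕ.* ((i ℕ.+ l) ! ℕ.* z)       ≡⟨ C-factorial i+l≤r ⟩
      r ! ∎
    right-side : (d ℕ.* e) ℕ.* (x ℕ.* (y ℕ.* z)) ≡ r !
    right-side = begin
      (d ℕ.* e) ℕ.* (x ℕ.* (y ℕ.* z))
        ≡⟨ solve 5 (λ d e x y z → (d :* e) :* (x :* (y :* z)) := d :* (x :* (e :* (y :* z)))) refl d e x y z ⟩
      d ℕ.* (x ℕ.* (e ℕ.* (y ℕ.* z))) ≡⟨ cong (λ t → d ℕ.* (x ℕ.* t)) eyz ⟩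
      d ℕ.* (x ℕ.* (r ∸ i) !)         ≡⟨ C-factorial (ℕP.m+n≤o⇒m≤o i i+l≤r) ⟩
      r ! ∎

  ⊛-cong : ∀ {f f′ g g′} → f ≋ f′ → g ≋ g′ → (f ⊛ g) ≋ (f′ ⊛ g′)
  ⊛-cong f≋f′ g≋g′ r = Σ-cong r (λ j → cong (binom r j *_) (cong₂ _*_ (f≋f′ j) (g≋g′ (r ∸ j))))

  ⊛-comm : ∀ f g → (f ⊛ g) ≋ (g ⊛ f)
  ⊛-comm f g r = trans (Σ-reverse r _) (Σ-cong≤ r reflected-term)
    where
    reflected-term : ∀ j → j ≤ r →
      binom r (r ∸ j) * (f (r ∸ j) * g (r ∸ (r ∸ j))) ≡ binom r j * (g j * f (r ∸ j))
    reflected-term j j≤r = cong₂ _*_ (cong ℕ→ℚ (sym (nCk≡nC[n∸k] j≤r)))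
      (trans (cong (λ t → f (r ∸ j) * g t) (ℕP.m∸[m∸n]≡n j≤r)) (ℚP.*-comm (f (r ∸ j)) (g j)))

  -- Associativity: both sides are the trinomial sum over i + l + (r-i-l) = r.
  ⊛-assoc : ∀ f g h → ((f ⊛ g) ⊛ h) ≋ (f ⊛ (g ⊛ h))
  ⊛-assoc f g h r = begin
    Σ r (λ j → binom r j * ((f ⊛ g) j * h (r ∸ j)))
      ≡⟨ Σ-cong r (λ j → trans (cong (binom r j *_) (Σ-*ʳ j (h (r ∸ j)) _)) (Σ-*ˡ j (binom r j) _)) ⟩
    Σ r (λ j → Σ j (λ i → binom r j * ((binom j i * (f i * g (j ∸ i))) * h (r ∸ j))))
      ≡⟨ Σ-triangle r (λ j i → binom r j * ((binom j i * (f i * g (j ∸ i))) * h (r ∸ j))) ⟩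
    Σ r (λ i → Σ (r ∸ i) (λ l → binom r (i ℕ.+ l) * ((binom (i ℕ.+ l) i * (f i * g ((i ℕ.+ l) ∸ i))) * h (r ∸ (i ℕ.+ l)))))
      ≡⟨ Σ-cong≤ r (λ i i≤r → Σ-cong≤ (r ∸ i) (λ l l≤r∸i →
           regroup i l (subst (i ℕ.+ l ≤_) (ℕP.m+[n∸m]≡n i≤r) (ℕP.+-monoʳ-≤ i l≤r∸i)))) ⟩
    Σ r (λ i → Σ (r ∸ i) (λ l → binom r i * (f i * (binom (r ∸ i) l * (g l * h ((r ∸ i) ∸ l))))))
      ≡⟨ Σ-cong r (λ i → sym (trans (cong (binom r i *_) (Σ-*ˡ (r ∸ i) (f i) _)) (Σ-*ˡ (r ∸ i) (binom r i) _))) ⟩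
    Σ r (λ i → binom r i * (f i * (g ⊛ h) (r ∸ i))) ∎
    where
    open +-*-Solver
    regroup : ∀ i l → i ℕ.+ l ≤ r →
      binom r (i ℕ.+ l) * ((binom (i ℕ.+ l) i * (f i * g ((i ℕ.+ l) ∸ i))) * h (r ∸ (i ℕ.+ l)))
        ≡ binom r i * (f i * (binom (r ∸ i) l * (g l * h ((r ∸ i) ∸ l))))
    regroup i l i+l≤r = begin
      binom r (i ℕ.+ l) * ((binom (i ℕ.+ l) i * (f i * g ((i ℕ.+ l) ∸ i))) * h (r ∸ (i ℕ.+ l)))
        ≡⟨ cong₂ (λ s t → binom r (i ℕ.+ l) * ((binom (i ℕ.+ l) i * (f i * g s)) * h t))
                 (ℕP.m+n∸m≡n i l) (sym (ℕP.∸-+-assoc r i l)) ⟩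
      A * ((B′ * (F * G)) * H)
        ≡⟨ solve 5 (λ A B F G H → A :* ((B :* (F :* G)) :* H) := (A :* B) :* (F :* (G :* H))) refl A B′ F G H ⟩
      (A * B′) * (F * (G * H))
        ≡⟨ cong (_* (F * (G * H))) (trans (sym (ℕ→ℚ-* (r C (i ℕ.+ l)) ((i ℕ.+ l) C i)))
             (trans (cong ℕ→ℚ (C-subset-of-subset r i l i+l≤r)) (ℕ→ℚ-* (r C i) ((r ∸ i) C l)))) ⟩
      (binom r i * binom (r ∸ i) l) * (F * (G * H))
        ≡⟨ solve 5 (λ A B F G H → (A :* B) :* (F :* (G :* H)) := A :* (F :* (B :* (G :* H))))
                 refl (binom r i) (binom (r ∸ i) l) F G H ⟩
      binom r i * (F * (binom (r ∸ i) l * (G * H))) ∎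
      where
      A B′ F G H : ℚ
      A = binom r (i ℕ.+ l)
      B′ = binom (i ℕ.+ l) i
      F = f i
      G = g l
      H = h ((r ∸ i) ∸ l)

  ⊛-identityˡ : ∀ f → (oneE ⊛ f) ≋ f
  ⊛-identityˡ f zero    = trans (ℚP.*-identityˡ _) (ℚP.*-identityˡ _)
  ⊛-identityˡ f (suc r) = begin
    (oneE ⊛ f) (suc r)
      ≡⟨ Σ-head r (λ j → binom (suc r) j * (oneE j * f (suc r ∸ j))) ⟩
    binom (suc r) 0 * (1ℚ * f (suc r)) + Σ r (λ i → binom (suc r) (suc i) * (0ℚ * f (r ∸ i)))
      ≡⟨ cong₂ _+_ (trans (ℚP.*-identityˡ _) (ℚP.*-identityˡ (f (suc r))))
                   (trans (Σ-cong r vanishing) (Σ-zero r)) ⟩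
    f (suc r) + 0ℚ
      ≡⟨ ℚP.+-identityʳ (f (suc r)) ⟩
    f (suc r) ∎
    where
    vanishing : ∀ i → binom (suc r) (suc i) * (0ℚ * f (r ∸ i)) ≡ 0ℚ
    vanishing i = trans (cong (binom (suc r) (suc i) *_) (ℚP.*-zeroˡ (f (r ∸ i))))
                        (ℚP.*-zeroʳ (binom (suc r) (suc i)))

  ⊛-identityʳ : ∀ f → (f ⊛ oneE) ≋ f
  ⊛-identityʳ f r = trans (⊛-comm f oneE r) (⊛-identityˡ f r)

  ⊛-Σʳ : ∀ n f (G : ℕ → EGF) → (f ⊛ (λ v → Σ n (λ i → G i v))) ≋ (λ r → Σ n (λ i → (f ⊛ G i) r))
  ⊛-Σʳ n f G r = trans
    (Σ-cong r (λ j → trans (cong (binom r j *_) (Σ-*ˡ n (f j) (λ i → G i (r ∸ j))))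
                           (Σ-*ˡ n (binom r j) (λ i → f j * G i (r ∸ j)))))
    (Σ-swap r n (λ j i → binom r j * (f j * G i (r ∸ j))))

  ⊛-scaleʳ : ∀ a f g → (f ⊛ (λ v → a * g v)) ≋ (λ r → a * (f ⊛ g) r)
  ⊛-scaleʳ a f g r = trans
    (Σ-cong r (λ j → solve 4 (λ C F A G → C :* (F :* (A :* G)) := A :* (C :* (F :* G)))
                            refl (binom r j) (f j) a (g (r ∸ j))))
    (sym (Σ-*ˡ r a (λ j → binom r j * (f j * g (r ∸ j)))))
    where open +-*-Solver

  ⊛-+ʳ : ∀ f g h → (f ⊛ (λ v → g v + h v)) ≋ (λ r → (f ⊛ g) r + (f ⊛ h) r)
  ⊛-+ʳ f g h r = trans
    (Σ-cong r (λ j → solve 4 (λ C F G H → C :* (F :* (G :+ H)) := C :* (F :* G) :+ C :* (F :* H))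
                            refl (binom r j) (f j) (g (r ∸ j)) (h (r ∸ j))))
    (Σ-+ r (λ j → binom r j * (f j * g (r ∸ j))) (λ j → binom r j * (f j * h (r ∸ j))))
    where open +-*-Solver

  -- e^{at} e^{bt} = e^{(a+b)t}: coefficientwise this is the binomial theorem,
  -- taken from the library after translating its notions of power, multiple
  -- and sum into ours.
  exp-law : ∀ a b → (expE a ⊛ expE b) ≋ expE (a + b)
  exp-law a b r = sym (begin
    (a + b) ^ℚ r                       ≡⟨ sym (^ᴿ-^ℚ (a + b) r) ⟩
    (a + b) ^ᴿ r                       ≡⟨ BinomialQ.theorem r a b ⟩
    BinomialQ.binomialExpansion a b r  ≡⟨ sumᴿ-Σ r _ ⟩
    Σ r (λ j → (r C j) ×ᴿ ((a ^ᴿ j) * (b ^ᴿ (r ∸ j))))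
      ≡⟨ Σ-cong r (λ j → trans (×ᴿ-binom (r C j) _)
                               (cong (binom r j *_) (cong₂ _*_ (^ᴿ-^ℚ a j) (^ᴿ-^ℚ b (r ∸ j))))) ⟩
    (expE a ⊛ expE b) r ∎)
    where
    module BinomialQ = Binomial (CommutativeRing.commutativeSemiring ℚ-ring)
    ×ᴿ-binom : ∀ m x → m ×ᴿ x ≡ ℕ→ℚ m * x
    ×ᴿ-binom zero    x = sym (ℚP.*-zeroˡ x)
    ×ᴿ-binom (suc m) x = begin
      x + m ×ᴿ x           ≡⟨ cong₂ _+_ (sym (ℚP.*-identityˡ x)) (×ᴿ-binom m x) ⟩
      1ℚ * x + ℕ→ℚ m * x   ≡⟨ sym (ℚP.*-distribʳ-+ x 1ℚ (ℕ→ℚ m)) ⟩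
      (1ℚ + ℕ→ℚ m) * x     ≡⟨ cong (_* x) (sym (ℕ→ℚ-+ 1 m)) ⟩
      ℕ→ℚ (suc m) * x      ∎
    ^ᴿ-^ℚ : ∀ x m → x ^ᴿ m ≡ x ^ℚ m
    ^ᴿ-^ℚ x zero    = refl
    ^ᴿ-^ℚ x (suc m) = cong (x *_) (^ᴿ-^ℚ x m)
    sumᴿ-Σ : ∀ n (g : ℕ → ℚ) → sumᴿ {suc n} (λ k → g (toℕ k)) ≡ Σ n g
    sumᴿ-Σ zero    g = ℚP.+-identityʳ (g 0)
    sumᴿ-Σ (suc n) g = trans (cong (g 0 +_) (sumᴿ-Σ n (λ i → g (suc i)))) (sym (Σ-head n g))

module EulerIdentity where

  open import Data.Nat.Combinatorics using (nCk+nC[k+1]≡[n+1]C[k+1]; nCn≡1; k>n⇒nCk≡0)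
  open import Data.Rational using (_+_; _*_)
  open import Data.List using (List; []; _∷_; _++_; length)
  open import Data.List.Properties using (length-++)
  open import Data.Sum using (inj₁; inj₂)
  import Data.Integer as ℤ
  open NatCast
  open FiniteSums
  open SeriesRing
  open ≡-Reasoning

  constE : ℚ → EGF
  constE c r = c * oneE r

  expPlusOne : EGF
  expPlusOne r = expE 1ℚ r + oneE r

  constE-⊛ : ∀ c g → (constE c ⊛ g) ≋ (λ r → c * g r)
  constE-⊛ c g r = trans (⊛-comm (constE c) g r)
    (trans (⊛-scaleʳ c g oneE r) (cong (c *_) (⊛-identityʳ g r)))

  powers-cancel : ∀ F G c → (F ⊛ G) ≋ constE c →
    ∀ n h → ((F ^E n) ⊛ ((G ^E n) ⊛ h)) ≋ (λ r → (c ^ℚ n) * h r)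
  powers-cancel F G c F⊛G≋c zero h r =
    trans (⊛-identityˡ (oneE ⊛ h) r) (trans (⊛-identityˡ h r) (sym (ℚP.*-identityˡ (h r))))
  powers-cancel F G c F⊛G≋c (suc n) h r = begin
    ((F ⊛ Fⁿ) ⊛ ((G ⊛ Gⁿ) ⊛ h)) r   ≡⟨ ⊛-assoc F Fⁿ ((G ⊛ Gⁿ) ⊛ h) r ⟩
    (F ⊛ (Fⁿ ⊛ ((G ⊛ Gⁿ) ⊛ h))) r   ≡⟨ ⊛-cong {F} (λ _ → refl) (λ s → trans
                                         (⊛-cong {Fⁿ} (λ _ → refl) (⊛-assoc G Gⁿ h) s) (F⊛G-swap s)) r ⟩
    (F ⊛ (G ⊛ Rest)) r              ≡⟨ sym (⊛-assoc F G Rest r) ⟩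
    ((F ⊛ G) ⊛ Rest) r              ≡⟨ ⊛-cong {g = Rest} F⊛G≋c (powers-cancel F G c F⊛G≋c n h) r ⟩
    (constE c ⊛ (λ s → c ^ℚ n * h s)) r ≡⟨ constE-⊛ c (λ s → c ^ℚ n * h s) r ⟩
    c * (c ^ℚ n * h r)              ≡⟨ sym (ℚP.*-assoc c (c ^ℚ n) (h r)) ⟩
    c ^ℚ suc n * h r ∎
    where
    Fⁿ Gⁿ Rest : EGF
    Fⁿ = F ^E n
    Gⁿ = G ^E n
    Rest = Fⁿ ⊛ (Gⁿ ⊛ h)
    F⊛G-swap : (Fⁿ ⊛ (G ⊛ (Gⁿ ⊛ h))) ≋ (G ⊛ Rest)
    F⊛G-swap = ≋-trans (λ s → sym (⊛-assoc Fⁿ G (Gⁿ ⊛ h) s))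
      (≋-trans (⊛-cong {g = Gⁿ ⊛ h} (⊛-comm Fⁿ G) (λ _ → refl)) (⊛-assoc G Fⁿ (Gⁿ ⊛ h)))

  pascal : ∀ n (t : ℕ → ℚ) →
    Σ n (λ i → binom n i * t (suc i)) + Σ n (λ i → binom n i * t i) ≡ Σ (suc n) (λ i → binom (suc n) i * t i)
  pascal n t = sym (begin
    Σ (suc n) (λ i → binom (suc n) i * t i)
      ≡⟨ Σ-head n (λ i → binom (suc n) i * t i) ⟩
    t0 + Σ n (λ i → binom (suc n) (suc i) * t (suc i))
      ≡⟨ cong (t0 +_) (trans (Σ-cong n split) (Σ-+ n _ _)) ⟩
    t0 + (Shifted + Upper)
      ≡⟨ solve 3 (λ a P Q → a :+ (P :+ Q) := P :+ (a :+ Q)) refl t0 Shifted Upper ⟩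
    Shifted + (t0 + Upper)
      ≡⟨ cong (Shifted +_) (sym (Σ-head n (λ i → binom n i * t i))) ⟩
    Shifted + (Σ n (λ i → binom n i * t i) + binom n (suc n) * t (suc n))
      ≡⟨ cong (λ x → Shifted + (Σ n (λ i → binom n i * t i) + ℕ→ℚ x * t (suc n)))
              (k>n⇒nCk≡0 {n} {suc n} ℕP.≤-refl) ⟩
    Shifted + (Σ n (λ i → binom n i * t i) + 0ℚ * t (suc n))
      ≡⟨ cong (λ x → Shifted + (Σ n (λ i → binom n i * t i) + x)) (ℚP.*-zeroˡ (t (suc n))) ⟩
    Shifted + (Σ n (λ i → binom n i * t i) + 0ℚ)
      ≡⟨ cong (Shifted +_) (ℚP.+-identityʳ _) ⟩
    Shifted + Σ n (λ i → binom n i * t i) ∎)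
    where
    open +-*-Solver
    t0 Shifted Upper : ℚ
    t0 = 1ℚ * t 0
    Shifted = Σ n (λ i → binom n i * t (suc i))
    Upper = Σ n (λ i → binom n (suc i) * t (suc i))
    split : ∀ i → binom (suc n) (suc i) * t (suc i) ≡ binom n i * t (suc i) + binom n (suc i) * t (suc i)
    split i = trans (cong (λ x → ℕ→ℚ x * t (suc i)) (sym (nCk+nC[k+1]≡[n+1]C[k+1] n i)))
      (trans (cong (_* t (suc i)) (ℕ→ℚ-+ (n C i) (n C suc i))) (ℚP.*-distribʳ-+ (t (suc i)) (binom n i) (binom n (suc i))))

  -- Σ_i C(n,i) e^{it}, which is (e^t + 1)^n by the binomial theorem.
  binomialExpSum : ℕ → EGF
  binomialExpSum n v = Σ n (λ i → binom n i * expE (ℕ→ℚ i) v)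

  binomialExpSum-suc : ∀ n → binomialExpSum (suc n) ≋ (expPlusOne ⊛ binomialExpSum n)
  binomialExpSum-suc n r = sym (begin
    (expPlusOne ⊛ binomialExpSum n) r
      ≡⟨ ⊛-comm expPlusOne (binomialExpSum n) r ⟩
    (binomialExpSum n ⊛ expPlusOne) r
      ≡⟨ ⊛-+ʳ (binomialExpSum n) (expE 1ℚ) oneE r ⟩
    (binomialExpSum n ⊛ expE 1ℚ) r + (binomialExpSum n ⊛ oneE) r
      ≡⟨ cong₂ _+_ (trans (⊛-comm (binomialExpSum n) (expE 1ℚ) r) shift) (⊛-identityʳ (binomialExpSum n) r) ⟩
    Σ n (λ i → binom n i * expE (ℕ→ℚ (suc i)) r) + binomialExpSum n r
      ≡⟨ pascal n (λ i → expE (ℕ→ℚ i) r) ⟩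
    binomialExpSum (suc n) r ∎)
    where
    shift : (expE 1ℚ ⊛ binomialExpSum n) r ≡ Σ n (λ i → binom n i * expE (ℕ→ℚ (suc i)) r)
    shift = trans (⊛-Σʳ n (expE 1ℚ) (λ i v → binom n i * expE (ℕ→ℚ i) v) r)
      (Σ-cong n (λ i → trans (⊛-scaleʳ (binom n i) (expE 1ℚ) (expE (ℕ→ℚ i)) r)
        (cong (binom n i *_) (trans (exp-law 1ℚ (ℕ→ℚ i) r) (cong (_^ℚ r) (sym (ℕ→ℚ-+ 1 i)))))))

  B-generating : ∀ n → (λ v → ℕ→ℚ (B v n)) ≋ (expPlusOne ^E n)
  B-generating n v = trans B-as-sum (as-power n v)
    where
    B-as-sum : ℕ→ℚ (B v n) ≡ binomialExpSum n v
    B-as-sum = trans (ℕ→ℚ-Σ n (λ i → (n C i) ℕ.* (i ℕ.^ v)))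
      (Σ-cong n (λ i → trans (ℕ→ℚ-* (n C i) (i ℕ.^ v)) (cong (binom n i *_) (ℕ→ℚ-^ i v))))
    as-power : ∀ n → binomialExpSum n ≋ (expPlusOne ^E n)
    as-power zero    zero    = refl
    as-power zero    (suc v) = trans (ℚP.*-identityˡ (0ℚ * (0ℚ ^ℚ v))) (ℚP.*-zeroˡ (0ℚ ^ℚ v))
    as-power (suc n) = ≋-trans (binomialExpSum-suc n) (⊛-cong {expPlusOne} (λ _ → refl) (as-power n))

  -- The list twoOverPrefix r is the prefix [a_0, …, a_r] of the
  -- coefficients a_j of 2/(e^t + 1); in particular a_j never changes once
  -- computed, and a_{r+1} obeys the recurrence of its definition.
  lookup-++ˡ : ∀ (xs ys : List ℚ) j → j < length xs → at (xs ++ ys) j ≡ at xs j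
  lookup-++ˡ (x ∷ xs) ys zero    _         = refl
  lookup-++ˡ (x ∷ xs) ys (suc j) (s≤s j<n) = lookup-++ˡ xs ys j j<n

  lookup-last : ∀ (xs : List ℚ) y → at (xs ++ y ∷ []) (length xs) ≡ y
  lookup-last []       y = refl
  lookup-last (x ∷ xs) y = lookup-last xs y

  length-prefix : ∀ r → length (twoOverPrefix r) ≡ suc r
  length-prefix zero    = refl
  length-prefix (suc r) = trans (length-++ (twoOverPrefix r))
    (trans (cong (ℕ._+ 1) (length-prefix r)) (ℕP.+-comm (suc r) 1))

  prefix-stable : ∀ r j → j ≤ r → at (twoOverPrefix r) j ≡ twoOverExpPlusOne j
  prefix-stable zero    zero z≤n = refl
  prefix-stable (suc r) j  j≤1+r with ℕP.m≤n⇒m<n∨m≡n j≤1+r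
  ... | inj₂ refl        = refl
  ... | inj₁ (s≤s j≤r) = trans
    (lookup-++ˡ (twoOverPrefix r) _ j (subst (j <_) (sym (length-prefix r)) (s≤s j≤r)))
    (prefix-stable r j j≤r)

  twoOver-recurrence : ∀ r →
    twoOverExpPlusOne (suc r) ≡ ℚ.- (ℤ.+ 1 ℚ./ 2) * Σ r (λ j → binom (suc r) j * twoOverExpPlusOne j)
  twoOver-recurrence r = trans
    (subst (λ k → at (twoOverPrefix r ++ next ∷ []) k ≡ next) (length-prefix r) (lookup-last (twoOverPrefix r) next))
    (cong (ℚ.- (ℤ.+ 1 ℚ./ 2) *_) (Σ-cong≤ r (λ j j≤r → cong (binom (suc r) j *_) (prefix-stable r j j≤r))))
    where
    next : ℚ
    next = ℚ.- (ℤ.+ 1 ℚ./ 2) * Σ r (λ j → binom (suc r) j * at (twoOverPrefix r) j)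

  1^ℚ : ∀ k → 1ℚ ^ℚ k ≡ 1ℚ
  1^ℚ zero    = refl
  1^ℚ (suc k) = trans (ℚP.*-identityˡ _) (1^ℚ k)

  expPlusOne⊛twoOver : (expPlusOne ⊛ twoOverExpPlusOne) ≋ constE (1ℚ + 1ℚ)
  expPlusOne⊛twoOver r = trans (⊛-comm expPlusOne twoOverExpPlusOne r)
    (trans (⊛-+ʳ a (expE 1ℚ) oneE r)
      (trans (cong₂ _+_ (Σ-cong r (λ j → cong (λ x → binom r j * (a j * x)) (1^ℚ (r ∸ j)))) (⊛-identityʳ a r))
        (coefficient r)))
    where
    a : EGF
    a = twoOverExpPlusOne
    coefficient : ∀ r → Σ r (λ j → binom r j * (a j * 1ℚ)) + a r ≡ constE (1ℚ + 1ℚ) r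
    coefficient zero    = refl
    coefficient (suc r) = begin
      (Σ r (λ j → binom (suc r) j * (a j * 1ℚ)) + binom (suc r) (suc r) * (a (suc r) * 1ℚ)) + a (suc r)
        ≡⟨ cong₂ (λ x y → (x + ℕ→ℚ y * (a (suc r) * 1ℚ)) + a (suc r))
                 (Σ-cong r (λ j → cong (binom (suc r) j *_) (ℚP.*-identityʳ (a j)))) (nCn≡1 (suc r)) ⟩
      (X + 1ℚ * (a (suc r) * 1ℚ)) + a (suc r)
        ≡⟨ cong₂ (λ x y → (X + 1ℚ * (x * 1ℚ)) + y) (twoOver-recurrence r) (twoOver-recurrence r) ⟩
      (X + 1ℚ * (h * X * 1ℚ)) + h * X
        ≡⟨ solve 2 (λ X h → (X :+ con 1ℚ :* (h :* X :* con 1ℚ)) :+ h :* X := (con 1ℚ :+ (h :+ h)) :* X) refl X h ⟩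
      (1ℚ + (h + h)) * X ≡⟨ ℚP.*-zeroˡ X ⟩
      0ℚ ≡⟨ sym (ℚP.*-zeroʳ (1ℚ + 1ℚ)) ⟩
      constE (1ℚ + 1ℚ) (suc r) ∎
      where
      open +-*-Solver
      h X : ℚ
      h = ℚ.- (ℤ.+ 1 ℚ./ 2)
      X = Σ r (λ j → binom (suc r) j * a j)

  euler-identity : ∀ n m k →
    Σ m (λ v → binom m v * (ℕ→ℚ (B v n) * EulerPoly n (m ∸ v) (ℕ→ℚ k)))
      ≡ ℕ→ℚ (2 ℕ.^ n) * ℕ→ℚ (k ℕ.^ m)
  euler-identity n m k = begin
    ((λ v → ℕ→ℚ (B v n)) ⊛ ((twoOverExpPlusOne ^E n) ⊛ expE (ℕ→ℚ k))) m
      ≡⟨ ⊛-cong {g = (twoOverExpPlusOne ^E n) ⊛ expE (ℕ→ℚ k)} (B-generating n) (λ _ → refl) m ⟩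
    ((expPlusOne ^E n) ⊛ ((twoOverExpPlusOne ^E n) ⊛ expE (ℕ→ℚ k))) m
      ≡⟨ powers-cancel expPlusOne twoOverExpPlusOne (1ℚ + 1ℚ) expPlusOne⊛twoOver n (expE (ℕ→ℚ k)) m ⟩
    (1ℚ + 1ℚ) ^ℚ n * ℕ→ℚ k ^ℚ m
      ≡⟨ cong₂ _*_ (sym (ℕ→ℚ-^ 2 n)) (sym (ℕ→ℚ-^ k m)) ⟩
    ℕ→ℚ (2 ℕ.^ n) * ℕ→ℚ (k ℕ.^ m) ∎

module Transfer {c ℓ} (R : CommutativeRing c ℓ) (ι : ℚ → CommutativeRing.Carrier R)
  (hom : RingMorphisms.IsRingHomomorphism (CommutativeRing.rawRing ℚ-ring) (CommutativeRing.rawRing R) ι)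
  where

  open CommutativeRing R
    using (Carrier; _≈_; _*_; setoid; +-cong; *-cong; distribˡ; distribʳ; commutativeSemiring)
    renaming (refl to ≈-refl; sym to ≈-sym; trans to ≈-trans; reflexive to ≈-reflexive)
  open RingMorphisms.IsRingHomomorphism hom using (+-homo; *-homo)
  open OverAlgebra R ι
  open import Relation.Binary.Reasoning.Setoid setoid
  open import Algebra.Solver.Ring.NaturalCoefficients.Default commutativeSemiring
    using (solve; _:*_; _:=_)
  open NatCast
  open FiniteSums using (Σ)
  open SeriesRing using (binom)
  open EulerIdentity using (euler-identity)

  ι-cong : ∀ {x y} → x ≡ y → ι x ≈ ι y
  ι-cong x≡y = ≈-reflexive (cong ι x≡y)

  ΣR-cong : ∀ n {f g : ℕ → Carrier} → (∀ i → f i ≈ g i) → ΣR≤ n f ≈ ΣR≤ n g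
  ΣR-cong zero    f≈g = f≈g 0
  ΣR-cong (suc n) f≈g = +-cong (ΣR-cong n f≈g) (f≈g (suc n))

  ΣR-*ˡ : ∀ n a (f : ℕ → Carrier) → ΣR≤ n (λ i → a * f i) ≈ a * ΣR≤ n f
  ΣR-*ˡ zero    a f = ≈-refl
  ΣR-*ˡ (suc n) a f = ≈-trans (+-cong (ΣR-*ˡ n a f) ≈-refl) (≈-sym (distribˡ a (ΣR≤ n f) (f (suc n))))

  ΣR-*ʳ : ∀ n a (f : ℕ → Carrier) → ΣR≤ n (λ i → f i * a) ≈ ΣR≤ n f * a
  ΣR-*ʳ zero    a f = ≈-refl
  ΣR-*ʳ (suc n) a f = ≈-trans (+-cong (ΣR-*ʳ n a f) ≈-refl) (≈-sym (distribʳ a (ΣR≤ n f) (f (suc n))))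

  ΣR-ι : ∀ n (g : ℕ → ℚ) → ΣR≤ n (λ i → ι (g i)) ≈ ι (Σ n g)
  ΣR-ι zero    g = ≈-refl
  ΣR-ι (suc n) g = ≈-trans (+-cong (ΣR-ι n g) ≈-refl) (≈-sym (+-homo (Σ n g) (g (suc n))))

  inner-sum : ∀ n m p lam k →
    ΣR≤ m (λ v → ι (ℕ→ℚ ((n C k) ℕ.^ p)) * ι (ℕ→ℚ (m C v)) * powR lam k
                   * ι (ℕ→ℚ (B v n)) * ι (EulerPoly n (m ∸ v) (ℕ→ℚ k)))
      ≈ (ι (ℕ→ℚ (((n C k) ℕ.^ p) ℕ.* (k ℕ.^ m))) * powR lam k) * ι (ℕ→ℚ (2 ℕ.^ n))
  inner-sum n m p lam k = begin
    ΣR≤ m (λ v → a * ι (binom m v) * L * ι (ℕ→ℚ (B v n)) * ι (E v))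
      ≈⟨ ΣR-cong m regroup ⟩
    ΣR≤ m (λ v → (a * L) * ι (binom m v ℚ.* (ℕ→ℚ (B v n) ℚ.* E v)))
      ≈⟨ ΣR-*ˡ m (a * L) _ ⟩
    (a * L) * ΣR≤ m (λ v → ι (binom m v ℚ.* (ℕ→ℚ (B v n) ℚ.* E v)))
      ≈⟨ *-cong ≈-refl (≈-trans (ΣR-ι m _) (ι-cong (euler-identity n m k))) ⟩
    (a * L) * ι (ℕ→ℚ (2 ℕ.^ n) ℚ.* ℕ→ℚ (k ℕ.^ m))
      ≈⟨ *-cong ≈-refl (*-homo _ _) ⟩
    (a * L) * (T * K)
      ≈⟨ solve 4 (λ a L T K → (a :* L) :* (T :* K) := ((a :* K) :* L) :* T) ≈-refl a L T K ⟩
    ((a * K) * L) * T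
      ≈⟨ *-cong (*-cong (≈-trans (≈-sym (*-homo _ _)) (ι-cong (sym (ℕ→ℚ-* ((n C k) ℕ.^ p) (k ℕ.^ m))))) ≈-refl) ≈-refl ⟩
    (ι (ℕ→ℚ (((n C k) ℕ.^ p) ℕ.* (k ℕ.^ m))) * L) * T ∎
    where
    a L T K : Carrier
    a = ι (ℕ→ℚ ((n C k) ℕ.^ p))
    L = powR lam k
    T = ι (ℕ→ℚ (2 ℕ.^ n))
    K = ι (ℕ→ℚ (k ℕ.^ m))
    E : ℕ → ℚ
    E v = EulerPoly n (m ∸ v) (ℕ→ℚ k)
    regroup : ∀ v → a * ι (binom m v) * L * ι (ℕ→ℚ (B v n)) * ι (E v)
                      ≈ (a * L) * ι (binom m v ℚ.* (ℕ→ℚ (B v n) ℚ.* E v))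
    regroup v = ≈-trans
      (solve 5 (λ a C L b e → a :* C :* L :* b :* e := (a :* L) :* (C :* (b :* e)))
             ≈-refl a (ι (binom m v)) L (ι (ℕ→ℚ (B v n))) (ι (E v)))
      (*-cong ≈-refl (≈-sym (≈-trans (*-homo _ _) (*-cong ≈-refl (*-homo _ _)))))

  theorem : ∀ n m p lam → y6 m n lam p ≈ rhs15 m n lam p
  theorem n m p lam = ≈-sym (begin
    rhs15 m n lam p
      ≈⟨ *-cong ≈-refl (ΣR-cong n (inner-sum n m p lam)) ⟩
    ι (inv-n!2^n n) * ΣR≤ n (λ k → Y k * T)
      ≈⟨ *-cong ≈-refl (ΣR-*ʳ n T Y) ⟩
    ι (inv-n!2^n n) * (ΣR≤ n Y * T)
      ≈⟨ solve 3 (λ a b t → a :* (b :* t) := (a :* t) :* b) ≈-refl (ι (inv-n!2^n n)) (ΣR≤ n Y) T ⟩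
    (ι (inv-n!2^n n) * T) * ΣR≤ n Y
      ≈⟨ *-cong (≈-trans (≈-sym (*-homo _ _)) (ι-cong (normaliser-ratio n))) ≈-refl ⟩
    y6 m n lam p ∎)
    where
    T : Carrier
    T = ι (ℕ→ℚ (2 ℕ.^ n))
    Y : ℕ → Carrier
    Y k = ι (ℕ→ℚ (((n C k) ℕ.^ p) ℕ.* (k ℕ.^ m))) * powR lam k

mainTheorem15 : ∀ {c ℓ} (R : CommutativeRing c ℓ) (ι : ℚ → CommutativeRing.Carrier R)
    → RingMorphisms.IsRingHomomorphism (CommutativeRing.rawRing ℚ-ring) (CommutativeRing.rawRing R) ι
    → (n m p : ℕ) → 1 ≤ n → (lam : CommutativeRing.Carrier R)
    → CommutativeRing._≈_ R (OverAlgebra.y6 R ι m n lam p) (OverAlgebra.rhs15 R ι m n lam p)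
mainTheorem15 R ι hom n m p _ lam = Transfer.theorem R ι hom n m p lam
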